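{- Let $S$ be a subset of a group $G$ and $H$ a subgroup of $G$. Suppose the composite map $S\hookrightarrow G\to G/H$ is surjective and at least one of its fibres consists of exactly one element. Then $H$ is a minimal complement of $S$ in $G$.
   Context: $G/H$ denotes the set of left cosets $gH$, i.e. equivalence classes for $g_1\sim g_2 \iff g_1^{ -1}g_2\in H$, and $G\to G/H$ is $g\mapsto gH$. For nonempty $W,W'\subseteq G$, $WW'=\{ww'\}$; $W'$ is a complement to $W$ if $WW'=G$, and a minimal complement if no proper subset of $W'$ is a complement to $W$. -}

module Defs where

open import Level using (Level; _⊔_)
open import Algebra.Bundles using (Group)
open import Data.Product using (Σ; ∃; _×_; _,_)
open import Relation.Unary using (Pred; _∈_; _∉_; _⊆_)
open import Relation.Nullary using (¬_)

module _ {c ℓ : Level} (G : Group c ℓ) where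
  open Group G

  RespectsEq : {p : Level} → Pred Carrier p → Set (c ⊔ ℓ ⊔ p)
  RespectsEq P = ∀ {x y} → x ≈ y → P x → P y

  record IsSubgroup {p : Level} (H : Pred Carrier p) : Set (c ⊔ ℓ ⊔ p) where
    field
      resp    : RespectsEq H
      ε-mem   : ε ∈ H
      ∙-mem   : ∀ {x y} → x ∈ H → y ∈ H → (x ∙ y) ∈ H
      ⁻¹-mem  : ∀ {x} → x ∈ H → (x ⁻¹) ∈ H

  -- left coset relation: g₁ H = g₂ H  iff  g₁⁻¹ g₂ ∈ H
  SameCoset : {p : Level} → Pred Carrier p → Carrier → Carrier → Set p
  SameCoset H g₁ g₂ = (g₁ ⁻¹ ∙ g₂) ∈ H

  CosetSurjective : {p : Level} → Pred Carrier p → Pred Carrier p → Set (c ⊔ p)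
  CosetSurjective S H = ∀ g → Σ Carrier λ s → s ∈ S × SameCoset H s g

  FibreSingleton : {p : Level} → Pred Carrier p → Pred Carrier p → Carrier → Set (c ⊔ ℓ ⊔ p)
  FibreSingleton S H g =
    Σ Carrier λ s → (s ∈ S × SameCoset H s g)
      × (∀ s' → s' ∈ S → SameCoset H s' g → s' ≈ s)

  IsComplement : {p : Level} → Pred Carrier p → Pred Carrier p → Set (c ⊔ ℓ ⊔ p)
  IsComplement W W' = ∀ g → Σ Carrier λ w → Σ Carrier λ w' → w ∈ W × w' ∈ W' × g ≈ w ∙ w'

  IsMinimalComplement : {p : Level} → Pred Carrier p → Pred Carrier p → Set (Level.suc p ⊔ c ⊔ ℓ)
  IsMinimalComplement {p} W W' =
    IsComplement W W' ×
    ((V : Pred Carrier p) → RespectsEq V → V ⊆ W' → (∃ λ x → x ∈ V)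
      → (∃ λ x → x ∈ W' × x ∉ V) → ¬ IsComplement W V)

-- If V ⊆ H is a complement to S and x ∈ H, write s₀ x = s v with s ∈ S, v ∈ V,
-- where s₀ is the lone element of S over its coset. Then s and s₀ lie in the
-- same coset, so s = s₀ and v = x: every element of H already lies in V.
module Submission where

open import Defs
open import Level using (Level)
open import Algebra.Bundles using (Group)
open import Relation.Unary using (Pred; _∈_; _⊆_)
open import Data.Product using (∃; _,_)

module _ {c ℓ : Level} (G : Group c ℓ) where
  open Group G
  open import Algebra.Properties.Group G using (\\-cong₂; \\-leftDividesˡ; \\-leftDividesʳ; x≈z//y; ∙-cancelˡ)
  open import Relation.Binary.Reasoning.Setoid setoid

  cosetSurjective⇒complement : {p : Level} {S H : Pred Carrier p}
    → CosetSurjective G S H → IsComplement G S H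
  cosetSurjective⇒complement surj g with surj g
  ... | s , s∈S , sH≡gH = s , s \\ g , s∈S , sH≡gH , sym (\\-leftDividesˡ s g)

  module _ {p : Level} {H : Pred Carrier p} (H≤G : IsSubgroup G H) where
    open IsSubgroup H≤G

    sameCoset-trans : ∀ {x y z} → SameCoset G H x y → SameCoset G H y z → SameCoset G H x z
    sameCoset-trans {x} {y} {z} xH≡yH yH≡zH = resp split (∙-mem xH≡yH yH≡zH)
      where
      split : (x \\ y) ∙ (y \\ z) ≈ x \\ z
      split = begin
        (x \\ y) ∙ (y \\ z)  ≈⟨ assoc (x ⁻¹) y (y \\ z) ⟩
        x ⁻¹ ∙ (y ∙ (y \\ z)) ≈⟨ ∙-congˡ (\\-leftDividesˡ y z) ⟩
        x \\ z               ∎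

    sameCoset-∙ : ∀ {x y h k} → x ∙ h ≈ y ∙ k → h ∈ H → k ∈ H → SameCoset G H y x
    sameCoset-∙ {x} {y} {h} {k} xh≈yk h∈H k∈H = resp (sym quotient) (∙-mem k∈H (⁻¹-mem h∈H))
      where
      quotient : y \\ x ≈ k // h
      quotient = begin
        y \\ x                ≈⟨ \\-cong₂ refl (x≈z//y x h (y ∙ k) xh≈yk) ⟩
        y ⁻¹ ∙ ((y ∙ k) // h) ≈⟨ assoc (y ⁻¹) (y ∙ k) (h ⁻¹) ⟨
        (y \\ (y ∙ k)) // h   ≈⟨ ∙-congʳ (\\-leftDividesʳ y k) ⟩
        k // h                ∎

    subgroup⊆complement : {S V : Pred Carrier p} → RespectsEq G V → V ⊆ H
      → IsComplement G S V → ∃ (FibreSingleton G S H) → H ⊆ V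
    subgroup⊆complement respV V⊆H V-complement (g₀ , s₀ , (s₀∈S , s₀H≡g₀H) , unique) {x} x∈H
      with V-complement (s₀ ∙ x)
    ... | s , v , s∈S , v∈V , s₀x≈sv = respV v≈x v∈V
      where
      s≈s₀ : s ≈ s₀
      s≈s₀ = unique s s∈S (sameCoset-trans (sameCoset-∙ s₀x≈sv x∈H (V⊆H v∈V)) s₀H≡g₀H)

      v≈x : v ≈ x
      v≈x = ∙-cancelˡ s₀ v x (trans (∙-congʳ (sym s≈s₀)) (sym s₀x≈sv))

lemma4p2 : {c ℓ p : Level} (G : Group c ℓ) (S H : Pred (Group.Carrier G) p)
    → RespectsEq G S → IsSubgroup G H
    → CosetSurjective G S H
    → (∃ λ g → FibreSingleton G S H g)
    → IsMinimalComplement G S H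
lemma4p2 G S H _ H≤G surj singleFibre =
  cosetSurjective⇒complement G surj ,
  λ V respV V⊆H _ (x , x∈H , x∉V) V-complement →
    x∉V (subgroup⊆complement G H≤G respV V⊆H V-complement singleFibre x∈H)
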